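{- For each $p\in\mathrm{OFS}(\mathbb{Z}^+)$, $$fw(p)\le \min(p)+\max(p)-\gcd(p)\,\bigl(|p|-1-r(p)\bigr).$$
   Context: $\mathrm{OFS}(\mathbb{Z}^+)$ denotes the set of all nonempty strictly increasing finite sequences of positive integers. For $p\in\mathrm{OFS}(\mathbb{Z}^+)$, $|p|$ is its length, $p_i$ its $i$-th entry, $p|_i=(p_1,\ldots,p_i)$ its truncation, $\gcd(p)$ the gcd of its entries, $\min(p)=p_1$, $\max(p)=p_{|p|}$. The map $R$: $R(p)=p$ if $|p|=1$; if $n=|p|>1$, form $(p_2-p_1,\ldots,p_n-p_1)$ and, if $p_1$ does not appear in it, insert $p_1$ so that the result is strictly increasing. The function $f$ is defined recursively by $f(p)=p_1$ if $|p|=1$ and $f(p)=p_1+f(R(p))$ if $|p|>1$. The function $fw:\mathrm{OFS}(\mathbb{Z}^+)\to\mathbb{Z}^+$ is defined by: if $n=|p|>1$, $\gcd(p|_{n-1})=\gcd(p)$ and $\max(p)\ge f(p|_{n-1})$, then $fw(p)=fw(p|_{n-1})$; otherwise $fw(p)=f(p)$. For $2\le j\le|p|$, the entry $p_j$ is called redundant in $p$ if $\gcd(p|_j)=\gcd(p|_{j-1})$ and $p_j\ge f(p|_{j-1})$; $r(p)$ denotes the number of redundant entries of $p$. -}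

module Defs where

open import Data.Nat using (ℕ; zero; suc; _+_; _*_; _∸_; _≤_; _<_; _≟_; _≤?_)
open import Data.Nat.GCD using (gcd)
open import Data.Bool using (Bool; true; false; if_then_else_; _∧_)
open import Data.List using (List; []; _∷_; map; reverse; length; foldr)
open import Data.Nat.ListAction using (sum)
open import Data.List.Relation.Unary.All using (All)
open import Data.List.Relation.Unary.Linked using (Linked)
open import Relation.Nullary.Decidable using (⌊_⌋)

-- OFS(ℤ⁺): nonempty (enforced by writing p = a ∷ rest), all entries
-- positive, strictly increasing.
OFS : List ℕ → Set
OFS p = All (0 <_) p × Linked _<_ p
  where open import Data.Product using (_×_)

-- gcd of a list (gcd of the entries; gcd [] = 0 is never used on OFS)
gcdL : List ℕ → ℕ
gcdL = foldr gcd 0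

-- max(p) = last entry of the nonempty list a ∷ rest
lastL : ℕ → List ℕ → ℕ
lastL a []       = a
lastL a (b ∷ bs) = lastL b bs

insertNew : ℕ → List ℕ → List ℕ
insertNew x []       = x ∷ []
insertNew x (y ∷ ys) =
  if ⌊ x ≟ y ⌋ then y ∷ ys
  else (if ⌊ x ≤? y ⌋ then x ∷ y ∷ ys else y ∷ insertNew x ys)

R : List ℕ → List ℕ
R []           = []
R (a ∷ [])     = a ∷ []
R (a ∷ b ∷ bs) = insertNew a (map (λ x → x ∸ a) (b ∷ bs))

-- f with fuel; on OFS inputs each R-step (|p|>1) strictly decreases the
-- sum of entries (all positive), so fuel = sum p is always sufficient
-- and the fuel-exhausted clause is never reached.
fFuel : ℕ → List ℕ → ℕ
fFuel zero    _            = 0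
fFuel (suc k) []           = 0
fFuel (suc k) (a ∷ [])     = a
fFuel (suc k) (a ∷ b ∷ bs) = a + fFuel k (R (a ∷ b ∷ bs))

f : List ℕ → ℕ
f p = fFuel (sum p) p

redundantStep : List ℕ → ℕ → Bool
redundantStep q x = ⌊ gcdL q ≟ gcdL (q Data.List.++ (x ∷ [])) ⌋ ∧ ⌊ f q ≤? x ⌋

-- fw, computed on the reversed list (head = last entry of p)
fwRev : List ℕ → ℕ
fwRev []           = 0
fwRev (x ∷ [])     = f (x ∷ [])
fwRev (x ∷ y ∷ ys) =
  if redundantStep (reverse (y ∷ ys)) x
  then fwRev (y ∷ ys)
  else f (reverse (x ∷ y ∷ ys))

fw : List ℕ → ℕ
fw p = fwRev (reverse p)

-- r(p): number of j ∈ {2..|p|} with p_j redundant in p|_j, on reversed list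
rRev : List ℕ → ℕ
rRev []           = 0
rRev (x ∷ [])     = 0
rRev (x ∷ y ∷ ys) =
  (if redundantStep (reverse (y ∷ ys)) x then 1 else 0) + rRev (y ∷ ys)

r : List ℕ → ℕ
r p = rRev (reverse p)

module Submission where

-- The proof reads f as the sharp length bound in a Fine–Wilf theorem for
-- several periods.  A word of length at least f(P) having every entry of P as
-- a period has period gcd(P) (f-periodicity); if every entry of P is below
-- f(P), some word of length f(P) - 1 has these periods but not gcd(P)
-- (f-sharp).  Both go by induction along R, since deleting the first p₁
-- letters of a word turns the periods P into the entries of R(P).  Together
-- with the classical Fine–Wilf theorem for two periods this bounds f under
-- appending an entry: f(q ∷ʳ x) ≤ max(f(q), x + gcd(q) - gcd(q ∷ʳ x))
-- (f-snoc-bound).  The theorem then follows by induction on p, appending one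
-- entry at a time, for a strengthened statement (Invariant) which also records
-- gcd(p) · (|p| - r(p)) ≤ p₁ and f(p) ≤ max(fw(p), max(p)).

open import Defs
open import Data.Nat using (ℕ; zero; suc; _+_; _*_; _∸_; _⊔_; _≤_; _<_; _≟_; _≤?_; _<?_; z≤n; s≤s; s≤s⁻¹; >-nonZero)
open import Data.Nat.Properties
open import Data.Nat.Divisibility using (_∣_; divides; ∣-refl; ∣⇒≤; 0∣⇒≡0; ∣-antisym; ∣-trans; _∣0; ∣m+n∣m⇒∣n; ∣m∸n∣n⇒∣m)
open import Data.Nat.GCD using (gcd; gcd-comm; gcd[m,n]∣m; gcd[m,n]∣n; gcd-greatest; gcd-assoc; gcd-identityˡ; gcd-identityʳ)
open import Data.List using (List; []; _∷_; map; _++_; _∷ʳ_; reverse; length)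
open import Data.List.Properties using (reverse-++; reverse-involutive; length-reverse; length-++)
open import Data.List.Reverse using (Reverse; []; _∶_∶ʳ_; reverseView)
open import Data.Nat.ListAction using (sum)
open import Algebra.Properties.CommutativeSemigroup +-commutativeSemigroup using (x∙yz≈y∙xz; x∙yz≈xz∙y; xy∙z≈xz∙y)
open import Data.List.Relation.Unary.All as All using (All; []; _∷_)
open import Data.List.Relation.Unary.Any using (here; there; any?)
open import Data.List.Relation.Unary.Linked as Linked using (Linked; []; [-]; _∷_)
open import Data.List.Relation.Unary.Linked.Properties using (Linked⇒All)
open import Data.List.Membership.Propositional using (_∈_; find; lose)
open import Data.List.Membership.Propositional.Properties using (∈-map⁺; ∈-map⁻; ∈-++⁺ˡ; ∈-++⁺ʳ; ∈-++⁻)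
open import Data.List.Relation.Unary.All.Properties using (++⁻ˡ)
open import Relation.Binary.Definitions using (Tri; tri<; tri≈; tri>)
open import Data.Product using (_×_; _,_; proj₁; proj₂; ∃-syntax)
open import Data.Sum using (_⊎_; inj₁; inj₂)
open import Relation.Nullary using (¬_)
open import Relation.Nullary.Decidable using (Dec; _×-dec_; isYes≗does; yes; no; does; dec-true; dec-false)
open import Data.Empty using (⊥-elim)
open import Data.Bool using (Bool; true; false; if_then_else_; _∧_)
open import Relation.Binary.PropositionalEquality
open import Function using (_∘_)

head-below : ∀ {a rest} → Linked _<_ (a ∷ rest) → All (a <_) rest
head-below [-]       = []
head-below (a<b ∷ l) = Linked⇒All <-trans a<b l

prepend-sorted : ∀ {z xs} → All (z <_) xs → Linked _<_ xs → Linked _<_ (z ∷ xs)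
prepend-sorted []          _ = [-]
prepend-sorted (z<x ∷ _)   l = z<x ∷ l

∈-insertNew⁻ : ∀ {y} x ys → y ∈ insertNew x ys → y ≡ x ⊎ y ∈ ys
∈-insertNew⁻ x [] (here y≡x) = inj₁ y≡x
∈-insertNew⁻ x (z ∷ zs) y∈ with x ≟ z
... | yes _ = inj₂ y∈
... | no _ with x ≤? z
∈-insertNew⁻ x (z ∷ zs) (here y≡x)  | no _ | yes _ = inj₁ y≡x
∈-insertNew⁻ x (z ∷ zs) (there y∈)  | no _ | yes _ = inj₂ y∈
∈-insertNew⁻ x (z ∷ zs) (here y≡z)  | no _ | no _  = inj₂ (here y≡z)
∈-insertNew⁻ x (z ∷ zs) (there y∈)  | no _ | no _  with ∈-insertNew⁻ x zs y∈
... | inj₁ y≡x  = inj₁ y≡x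
... | inj₂ y∈zs = inj₂ (there y∈zs)

x∈insertNew : ∀ x ys → x ∈ insertNew x ys
x∈insertNew x [] = here refl
x∈insertNew x (z ∷ zs) with x ≟ z
... | yes x≡z = here x≡z
... | no _ with x ≤? z
...   | yes _ = here refl
...   | no _  = there (x∈insertNew x zs)

∈-insertNew⁺ : ∀ {y} x ys → y ∈ ys → y ∈ insertNew x ys
∈-insertNew⁺ x (z ∷ zs) y∈ with x ≟ z
... | yes _ = y∈
... | no _ with x ≤? z
...   | yes _ = there y∈
∈-insertNew⁺ x (z ∷ zs) (here y≡z) | no _ | no _ = here y≡z
∈-insertNew⁺ x (z ∷ zs) (there y∈) | no _ | no _ = there (∈-insertNew⁺ x zs y∈)

insertNew-sorted : ∀ x ys → Linked _<_ ys → Linked _<_ (insertNew x ys)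
insertNew-sorted x [] _ = [-]
insertNew-sorted x (z ∷ zs) l with x ≟ z
... | yes _ = l
... | no x≢z with x ≤? z
...   | yes x≤z = ≤∧≢⇒< x≤z x≢z ∷ l
...   | no x≰z  = prepend-sorted (All.tabulate z<) (insertNew-sorted x zs (Linked.tail l))
  where
  z< : ∀ {y} → y ∈ insertNew x zs → z < y
  z< y∈ with ∈-insertNew⁻ x zs y∈
  ... | inj₁ refl = ≰⇒> x≰z
  ... | inj₂ y∈zs = All.lookup (head-below l) y∈zs

-- The map R on OFS

module _ {a b bs} (ofs : OFS (a ∷ b ∷ bs)) where

  private
    a<tail : All (a <_) (b ∷ bs)
    a<tail = head-below (proj₂ ofs)

  first≤ : ∀ {c} → c ∈ b ∷ bs → a ≤ c
  first≤ c∈ = <⇒≤ (All.lookup a<tail c∈)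

  first-least : ∀ {c} → c ∈ a ∷ b ∷ bs → a ≤ c
  first-least (here refl) = ≤-refl
  first-least (there c∈)  = first≤ c∈

  a∈R : a ∈ R (a ∷ b ∷ bs)
  a∈R = x∈insertNew a _

  ∸∈R : ∀ {c} → c ∈ b ∷ bs → c ∸ a ∈ R (a ∷ b ∷ bs)
  ∸∈R c∈ = ∈-insertNew⁺ a _ (∈-map⁺ (_∸ a) c∈)

  ∈R⁻ : ∀ {y} → y ∈ R (a ∷ b ∷ bs) → y ≡ a ⊎ ∃[ c ] (c ∈ b ∷ bs × y ≡ c ∸ a)
  ∈R⁻ y∈ with ∈-insertNew⁻ a _ y∈
  ... | inj₁ y≡a = inj₁ y≡a
  ... | inj₂ y∈map = inj₂ (∈-map⁻ (_∸ a) y∈map)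

  R-OFS : OFS (R (a ∷ b ∷ bs))
  R-OFS = All.tabulate positive , insertNew-sorted a _ (differences-sorted (b ∷ bs) a<tail (Linked.tail (proj₂ ofs)))
    where
    positive : ∀ {y} → y ∈ R (a ∷ b ∷ bs) → 0 < y
    positive y∈ with ∈R⁻ y∈
    ... | inj₁ refl = All.head (proj₁ ofs)
    ... | inj₂ (c , c∈ , refl) = m<n⇒0<n∸m (All.lookup a<tail c∈)
    differences-sorted : ∀ xs → All (a <_) xs → Linked _<_ xs → Linked _<_ (map (_∸ a) xs)
    differences-sorted []           _              _         = []
    differences-sorted (x ∷ [])     _              _         = [-]
    differences-sorted (x ∷ y ∷ ys) (a<x ∷ a<ys)   (x<y ∷ l) =
      ∸-monoˡ-< x<y (<⇒≤ a<x) ∷ differences-sorted (y ∷ ys) a<ys l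

  R-fuel : ∀ {k} → sum (a ∷ b ∷ bs) ≤ suc k → sum (R (a ∷ b ∷ bs)) ≤ k
  R-fuel {k} fuel = s≤s⁻¹ (begin
    suc (sum (insertNew a (map (_∸ a) (b ∷ bs))))  ≤⟨ s≤s (sum-insertNew a _) ⟩
    suc (a + ((b ∸ a) + sum (map (_∸ a) bs)))      ≡⟨ cong suc (sym (+-assoc a _ _)) ⟩
    suc (a + (b ∸ a) + sum (map (_∸ a) bs))        ≡⟨ cong (λ t → suc (t + _)) (m+[n∸m]≡n (first≤ (here refl))) ⟩
    suc (b + sum (map (_∸ a) bs))                  ≤⟨ s≤s (+-monoʳ-≤ b (sum-differences bs)) ⟩
    suc (b + sum bs)                               ≤⟨ +-monoˡ-≤ _ (All.head (proj₁ ofs)) ⟩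
    sum (a ∷ b ∷ bs)                               ≤⟨ fuel ⟩
    suc k                                          ∎)
    where
    open ≤-Reasoning
    sum-insertNew : ∀ x ys → sum (insertNew x ys) ≤ x + sum ys
    sum-insertNew x [] = ≤-refl
    sum-insertNew x (z ∷ zs) with x ≟ z
    ... | yes _ = m≤n+m _ x
    ... | no _ with x ≤? z
    ...   | yes _ = ≤-refl
    ...   | no _  = ≤-trans (+-monoʳ-≤ z (sum-insertNew x zs)) (≤-reflexive (x∙yz≈y∙xz z x (sum zs)))
    sum-differences : ∀ xs → sum (map (_∸ a) xs) ≤ sum xs
    sum-differences [] = ≤-refl
    sum-differences (x ∷ xs) = +-mono-≤ (m∸n≤m x a) (sum-differences xs)

gcdL-∣ : ∀ P {y} → y ∈ P → gcdL P ∣ y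
gcdL-∣ (x ∷ xs) (here refl) = gcd[m,n]∣m x _
gcdL-∣ (x ∷ xs) (there y∈) = ∣-trans (gcd[m,n]∣n x _) (gcdL-∣ xs y∈)

gcdL-greatest : ∀ P {d} → (∀ {y} → y ∈ P → d ∣ y) → d ∣ gcdL P
gcdL-greatest []       _   = _ ∣0
gcdL-greatest (x ∷ xs) d∣ = gcd-greatest (d∣ (here refl)) (gcdL-greatest xs (d∣ ∘ there))

gcdL-snoc : ∀ xs x → gcdL (xs ∷ʳ x) ≡ gcd (gcdL xs) x
gcdL-snoc []       x = trans (gcd-identityʳ x) (sym (gcd-identityˡ x))
gcdL-snoc (y ∷ xs) x = trans (cong (gcd y) (gcdL-snoc xs x)) (sym (gcd-assoc y _ x))

gcdL-positive : ∀ {a rest} → OFS (a ∷ rest) → 0 < gcdL (a ∷ rest)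
gcdL-positive {a} {rest} ofs = n≢0⇒n>0 λ g≡0 →
  <⇒≢ (All.head (proj₁ ofs)) (sym (0∣⇒≡0 (subst (_∣ a) g≡0 (gcdL-∣ (a ∷ rest) (here refl)))))

∣-∸ : ∀ {d m n} → m ≤ n → d ∣ m → d ∣ n → d ∣ n ∸ m
∣-∸ {d} m≤n d∣m d∣n = ∣m+n∣m⇒∣n (subst (d ∣_) (sym (m+[n∸m]≡n m≤n)) d∣n) d∣m

gcdL-R : ∀ {a b bs} → OFS (a ∷ b ∷ bs) → gcdL (R (a ∷ b ∷ bs)) ≡ gcdL (a ∷ b ∷ bs)
gcdL-R {a} {b} {bs} ofs = ∣-antisym (gcdL-greatest P gcdR∣) (gcdL-greatest (R P) gcdP∣)
  where
  P = a ∷ b ∷ bs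
  gcdR∣a : gcdL (R P) ∣ a
  gcdR∣a = gcdL-∣ (R P) (a∈R ofs)
  gcdR∣ : ∀ {y} → y ∈ P → gcdL (R P) ∣ y
  gcdR∣ (here refl) = gcdR∣a
  gcdR∣ (there c∈)  = ∣m∸n∣n⇒∣m _ (first≤ ofs c∈) (gcdL-∣ (R P) (∸∈R ofs c∈)) gcdR∣a
  gcdP∣ : ∀ {y} → y ∈ R P → gcdL P ∣ y
  gcdP∣ y∈ with ∈R⁻ ofs y∈
  ... | inj₁ refl = gcdL-∣ P (here refl)
  ... | inj₂ (c , c∈ , refl) = ∣-∸ (first≤ ofs c∈) (gcdL-∣ P (here refl)) (gcdL-∣ P (there c∈))

fuel-positive : ∀ {a P} → OFS (a ∷ P) → ¬ sum (a ∷ P) ≤ 0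
fuel-positive (0<a ∷ _ , _) fuel = <-irrefl refl (<-≤-trans 0<a (≤-trans (m≤m+n _ _) fuel))

-- Every entry of p is at most f(p): f(p) = p₁ + f(R p) and pⱼ - p₁ ∈ R p.
f-≥-member : ∀ k P → OFS P → sum P ≤ k → ∀ {y} → y ∈ P → y ≤ fFuel k P
f-≥-member zero    (a ∷ P)      ofs fuel _           = ⊥-elim (fuel-positive ofs fuel)
f-≥-member (suc k) (a ∷ [])     _   _    (here refl) = ≤-refl
f-≥-member (suc k) (a ∷ b ∷ bs) ofs fuel (here refl) = m≤m+n a _
f-≥-member (suc k) (a ∷ b ∷ bs) ofs fuel {c} (there c∈) = begin
  c                          ≡⟨ m+[n∸m]≡n (first≤ ofs c∈) ⟨
  a + (c ∸ a)                ≤⟨ +-monoʳ-≤ a (f-≥-member k _ (R-OFS ofs) (R-fuel ofs fuel) (∸∈R ofs c∈)) ⟩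
  a + fFuel k (R (a ∷ b ∷ bs)) ∎
  where open ≤-Reasoning

gcd[m,n∸m] : ∀ m n → m ≤ n → gcd m (n ∸ m) ≡ gcd m n
gcd[m,n∸m] m n m≤n = ∣-antisym
  (gcd-greatest (gcd[m,n]∣m m _) (∣m∸n∣n⇒∣m _ m≤n (gcd[m,n]∣n m _) (gcd[m,n]∣m m _)))
  (gcd-greatest (gcd[m,n]∣m m _) (∣-∸ m≤n (gcd[m,n]∣m m _) (gcd[m,n]∣n m _)))

-- For two entries, f(a,b) + gcd(a,b) ≤ a + b; this is the Euclidean algorithm,
-- since R(a,b) consists of a and b - a.
f-pair : ∀ {a b} → 0 < a → a < b → f (a ∷ b ∷ []) + gcd a b ≤ a + b
f-pair {a} {b} 0<a a<b = bound (sum (a ∷ b ∷ [])) 0<a a<b (≤-reflexive (cong (a +_) (sym (+-identityʳ b))))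
  where
  euclid-step : ∀ {a b} F → a ≤ b → F + gcd a (b ∸ a) ≤ b → a + F + gcd a b ≤ a + b
  euclid-step {a} {b} F a≤b IH = begin
    a + F + gcd a b         ≡⟨ +-assoc a F _ ⟩
    a + (F + gcd a b)       ≡⟨ cong (λ t → a + (F + t)) (gcd[m,n∸m] a b a≤b) ⟨
    a + (F + gcd a (b ∸ a)) ≤⟨ +-monoʳ-≤ a IH ⟩
    a + b                   ∎
    where open ≤-Reasoning
  fuel-left : ∀ {a b k} → 0 < a → a + b ≤ suc k → b ≤ k
  fuel-left {b = b} 0<a fuel = s≤s⁻¹ (<-≤-trans (m<n+m b 0<a) fuel)
  fFuel-single : ∀ {k c} → 0 < k → fFuel k (c ∷ []) ≡ c
  fFuel-single {suc k} _ = refl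
  bound : ∀ k {a b} → 0 < a → a < b → a + b ≤ k → fFuel k (a ∷ b ∷ []) + gcd a b ≤ a + b
  bound zero    0<a a<b fuel = ⊥-elim (<-irrefl refl (<-≤-trans 0<a (≤-trans (m≤m+n _ _) fuel)))
  bound (suc k) {a} {b} 0<a a<b fuel with a ≟ b ∸ a
  ... | yes a≡b-a = begin
    a + fFuel k (b ∸ a ∷ []) + gcd a b ≡⟨ cong (λ t → a + t + gcd a b) single ⟩
    a + (b ∸ a) + gcd a b              ≡⟨ cong (_+ gcd a b) (m+[n∸m]≡n (<⇒≤ a<b)) ⟩
    b + gcd a b                        ≤⟨ +-monoʳ-≤ b (∣⇒≤ ⦃ >-nonZero 0<a ⦄ (gcd[m,n]∣m a b)) ⟩
    b + a                              ≡⟨ +-comm b a ⟩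
    a + b                              ∎
    where
    open ≤-Reasoning
    single : fFuel k (b ∸ a ∷ []) ≡ b ∸ a
    single = fFuel-single (<-≤-trans (<-trans 0<a a<b) (fuel-left 0<a fuel))
  ... | no a≢b-a with a ≤? b ∸ a
  ...   | yes a≤b-a = euclid-step (fFuel k (a ∷ b ∸ a ∷ [])) (<⇒≤ a<b)
            (subst (fFuel k (a ∷ b ∸ a ∷ []) + gcd a (b ∸ a) ≤_) a+[b∸a]≡b
              (bound k 0<a (≤∧≢⇒< a≤b-a a≢b-a) (subst (_≤ k) (sym a+[b∸a]≡b) (fuel-left 0<a fuel))))
    where
    a+[b∸a]≡b : a + (b ∸ a) ≡ b
    a+[b∸a]≡b = m+[n∸m]≡n (<⇒≤ a<b)
  ...   | no a≰b-a = euclid-step (fFuel k (b ∸ a ∷ a ∷ [])) (<⇒≤ a<b)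
            (subst₂ (λ g t → fFuel k (b ∸ a ∷ a ∷ []) + g ≤ t) (gcd-comm (b ∸ a) a) [b∸a]+a≡b
              (bound k (m<n⇒0<n∸m a<b) (≰⇒> a≰b-a) (subst (_≤ k) (sym [b∸a]+a≡b) (fuel-left 0<a fuel))))
    where
    [b∸a]+a≡b : b ∸ a + a ≡ b
    [b∸a]+a≡b = m∸n+n≡m (<⇒≤ a<b)

-- Periods of words

-- The word w of length L (letters w 0, …, w (L - 1)) has period p.
HasPeriod : ℕ → (ℕ → ℕ) → ℕ → Set
HasPeriod L w p = ∀ i → i + p < L → w i ≡ w (i + p)

period-cong : ∀ {L u v p} → (∀ i → u i ≡ v i) → HasPeriod L u p → HasPeriod L v p
period-cong {p = p} u≗v per i i+p<L = trans (sym (u≗v i)) (trans (per i i+p<L) (u≗v (i + p)))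

period-multiple : ∀ {L w p m} → p ∣ m → HasPeriod L w p → HasPeriod L w m
period-multiple {L} {w} {p} (divides q refl) per = multiple q
  where
  multiple : ∀ q → HasPeriod L w (q * p)
  multiple zero    i _  = cong w (sym (+-identityʳ i))
  multiple (suc q) i lt = begin
    w i                 ≡⟨ per i (≤-<-trans (+-monoʳ-≤ i (m≤m+n p (q * p))) lt) ⟩
    w (i + p)           ≡⟨ multiple q (i + p) (subst (_< L) (sym (+-assoc i p (q * p))) lt) ⟩
    w (i + p + q * p)   ≡⟨ cong w (+-assoc i p (q * p)) ⟩
    w (i + (p + q * p)) ∎
    where open ≡-Reasoning

shift : ℕ → (ℕ → ℕ) → (ℕ → ℕ)
shift a w i = w (i + a)

<∸⇒+< : ∀ {x a L} → x < L ∸ a → x + a < L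
<∸⇒+< {x} {zero}  lt = subst (_< _) (sym (+-identityʳ x)) lt
<∸⇒+< {x} {suc a} {suc L} lt = subst (_< suc L) (sym (+-suc x a)) (s≤s (<∸⇒+< {x} {a} {L} lt))

shift-period : ∀ {L w a p} → HasPeriod L w p → HasPeriod (L ∸ a) (shift a w) p
shift-period {L} {w} {a} {p} per i lt =
  trans (per (i + a) (subst (_< L) (xy∙z≈xz∙y i p a) (<∸⇒+< lt))) (cong w (xy∙z≈xz∙y i a p))

shift-difference-period : ∀ {L w a c} → a ≤ c → HasPeriod L w a → HasPeriod L w c →
                          HasPeriod (L ∸ a) (shift a w) (c ∸ a)
shift-difference-period {L} {w} {a} {c} a≤c per-a per-c i lt = begin
  w (i + a)             ≡⟨ per-a i (≤-<-trans (+-monoʳ-≤ i a≤c) i+c<L) ⟨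
  w i                   ≡⟨ per-c i i+c<L ⟩
  w (i + c)             ≡⟨ cong w shifted-index ⟨
  w (i + (c ∸ a) + a)   ∎
  where
  open ≡-Reasoning
  shifted-index : i + (c ∸ a) + a ≡ i + c
  shifted-index = trans (+-assoc i (c ∸ a) a) (cong (i +_) (m∸n+n≡m a≤c))
  i+c<L : i + c < L
  i+c<L = subst (_< L) shifted-index (<∸⇒+< lt)

period-from-shift : ∀ {L w a g} → g ∣ a → 0 < a → a + a ≤ L → HasPeriod L w a →
                    HasPeriod (L ∸ a) (shift a w) g → HasPeriod L w g
period-from-shift {L} {w} {a} {g} g∣a 0<a 2a≤L per-a per-g i i+g<L with a ≤? i
... | yes a≤i = begin
  w i                   ≡⟨ cong w (m∸n+n≡m a≤i) ⟨
  w (i ∸ a + a)         ≡⟨ per-g (i ∸ a) (m+n≤o⇒m≤o∸n (suc (i ∸ a + g)) (subst (_< L) (sym index) i+g<L)) ⟩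
  w (i ∸ a + g + a)     ≡⟨ cong w index ⟩
  w (i + g)             ∎
  where
  open ≡-Reasoning
  index : i ∸ a + g + a ≡ i + g
  index = trans (xy∙z≈xz∙y (i ∸ a) g a) (cong (_+ g) (m∸n+n≡m a≤i))
... | no a≰i = trans (per-a i (<-≤-trans (+-monoˡ-< a (≰⇒> a≰i)) 2a≤L)) (head-letter (≰⇒> a≰i))
  where
  a≤L∸a : a ≤ L ∸ a
  a≤L∸a = m+n≤o⇒m≤o∸n a 2a≤L
  head-letter : i < a → w (i + a) ≡ w (i + g)
  head-letter i<a with a ≤? i + g
  ... | no a≰i+g = trans (per-g i (<-≤-trans (≰⇒> a≰i+g) a≤L∸a))
                         (sym (per-a (i + g) (<-≤-trans (+-monoˡ-< a (≰⇒> a≰i+g)) 2a≤L)))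
  ... | yes a≤i+g = begin
    w (i + a)                     ≡⟨ cong (λ t → w (t + a)) index ⟨
    w (j + (a ∸ g) + a)           ≡⟨ period-multiple g∣a∸g per-g j (subst (_< L ∸ a) (sym index) (<-≤-trans i<a a≤L∸a)) ⟨
    w (j + a)                     ≡⟨ cong w (m∸n+n≡m a≤i+g) ⟩
    w (i + g)                     ∎
    where
    open ≡-Reasoning
    j = i + g ∸ a
    g≤a : g ≤ a
    g≤a = ∣⇒≤ ⦃ >-nonZero 0<a ⦄ g∣a
    g∣a∸g : g ∣ a ∸ g
    g∣a∸g = ∣-∸ g≤a ∣-refl g∣a
    index : j + (a ∸ g) ≡ i
    index = begin
      j + (a ∸ g)   ≡⟨ +-∸-assoc j g≤a ⟨
      j + a ∸ g     ≡⟨ cong (_∸ g) (m∸n+n≡m a≤i+g) ⟩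
      i + g ∸ g     ≡⟨ m+n∸n≡m i g ⟩
      i             ∎

-- f is the sharp length bound in a Fine–Wilf theorem for several periods

-- Deleting the first p₁ letters turns the
-- periods of P into the entries of R(P), so induction applies.
f-periodicity : ∀ k P → OFS P → sum P ≤ k → ∀ {L w} → fFuel k P ≤ L →
                (∀ {p} → p ∈ P → HasPeriod L w p) → HasPeriod L w (gcdL P)
f-periodicity k       []           _   _    {w = w} _ _ i _ = cong w (sym (+-identityʳ i))
f-periodicity zero    (a ∷ P)      ofs fuel _ _ = ⊥-elim (fuel-positive ofs fuel)
f-periodicity (suc k) (a ∷ [])     _   _    {L} {w} _ per =
  subst (HasPeriod L w) (sym (gcd-identityʳ a)) (per (here refl))
f-periodicity (suc k) (a ∷ b ∷ bs) ofs fuel {L} {w} f≤L per =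
  period-from-shift (gcdL-∣ P (here refl)) (All.head (proj₁ ofs)) 2a≤L (per (here refl)) shifted-gcd
  where
  P = a ∷ b ∷ bs
  fR = fFuel k (R P)
  fR≤L∸a : fR ≤ L ∸ a
  fR≤L∸a = m+n≤o⇒m≤o∸n fR (subst (_≤ L) (+-comm a fR) f≤L)
  2a≤L : a + a ≤ L
  2a≤L = ≤-trans (+-monoʳ-≤ a (f-≥-member k (R P) (R-OFS ofs) (R-fuel ofs fuel) (a∈R ofs))) f≤L
  shifted-periods : ∀ {p} → p ∈ R P → HasPeriod (L ∸ a) (shift a w) p
  shifted-periods p∈ with ∈R⁻ ofs p∈
  ... | inj₁ refl            = shift-period (per (here refl))
  ... | inj₂ (c , c∈ , refl) = shift-difference-period (first≤ ofs c∈) (per (here refl)) (per (there c∈))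
  shifted-gcd : HasPeriod (L ∸ a) (shift a w) (gcdL P)
  shifted-gcd = subst (HasPeriod (L ∸ a) (shift a w)) (gcdL-R ofs)
    (f-periodicity k (R P) (R-OFS ofs) (R-fuel ofs fuel) fR≤L∸a shifted-periods)

record Counterexample (P : List ℕ) (F : ℕ) : Set where
  field
    len      : ℕ
    word     : ℕ → ℕ
    long     : F ≤ suc len
    periodic : ∀ {p} → p ∈ P → HasPeriod len word p
    not-gcd  : ¬ HasPeriod len word (gcdL P)

bit : Bool → ℕ
bit d = if d then 1 else 0

marker : ℕ → (ℕ → ℕ)
marker n i = bit (does (i ≟ n))

-- If F ≤ p₁ and p₂ < p₁ + F, a single marked letter in the middle of a word of
-- length 2p₁ - 1 is a counterexample for p₁ + F (used with F = f(R p)).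
marker-counterexample : ∀ {a b bs F} → OFS (a ∷ b ∷ bs) → b < a + F → F ≤ a →
                        Counterexample (a ∷ b ∷ bs) (a + F)
marker-counterexample {zero} ((() ∷ _) , _) _ _
marker-counterexample {suc a′} {b} {bs} {F} ofs b<a+F F≤a = record
  { len = a + a′ ; word = marker a′ ; long = long ; periodic = periodic ; not-gcd = not-gcd }
  where
  a = suc a′
  long : a + F ≤ suc (a + a′)
  long = subst (a + F ≤_) (+-suc a a′) (+-monoʳ-≤ a F≤a)
  unmarked : ∀ {i} → i ≢ a′ → marker a′ i ≡ 0
  unmarked {i} i≢a′ = cong bit (dec-false (i ≟ a′) i≢a′)
  periodic : ∀ {p} → p ∈ a ∷ b ∷ bs → HasPeriod (a + a′) (marker a′) p
  periodic {p} p∈ i i+p<L = trans (unmarked i≢a′) (sym (unmarked i+p≢a′))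
    where
    a≤p : a ≤ p
    a≤p = first-least ofs p∈
    i≢a′ : i ≢ a′
    i≢a′ refl = <-irrefl refl (≤-<-trans (subst (_≤ a′ + p) (+-comm a′ a) (+-monoʳ-≤ a′ a≤p)) i+p<L)
    i+p≢a′ : i + p ≢ a′
    i+p≢a′ i+p≡a′ = <-irrefl refl (≤-trans (≤-trans a≤p (m≤n+m p i)) (≤-reflexive i+p≡a′))
  g = gcdL (a ∷ b ∷ bs)
  g<a : g < a
  g<a = begin-strict
    g        ≤⟨ ∣⇒≤ ⦃ >-nonZero (m<n⇒0<n∸m a<b) ⦄ g∣b∸a ⟩
    b ∸ a    <⟨ ∸-monoˡ-< (<-≤-trans b<a+F (+-monoʳ-≤ a F≤a)) (<⇒≤ a<b) ⟩
    a + a ∸ a ≡⟨ m+n∸n≡m a a ⟩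
    a        ∎
    where
    open ≤-Reasoning
    a<b : a < b
    a<b = Linked.head (proj₂ ofs)
    g∣b∸a : g ∣ b ∸ a
    g∣b∸a = ∣-∸ (<⇒≤ a<b) (gcdL-∣ (a ∷ b ∷ bs) (here refl)) (gcdL-∣ (a ∷ b ∷ bs) (there (here refl)))
  not-gcd : ¬ HasPeriod (a + a′) (marker a′) g
  not-gcd per = 1≢0 (begin
    1               ≡⟨ cong bit (dec-true (a′ ≟ a′) refl) ⟨
    marker a′ a′    ≡⟨ per a′ (subst (a′ + g <_) (+-comm a′ a) (+-monoʳ-< a′ g<a)) ⟩
    marker a′ (a′ + g) ≡⟨ unmarked (λ a′+g≡a′ → <⇒≢ (m<m+n a′ (gcdL-positive ofs)) (sym a′+g≡a′)) ⟩
    0               ∎)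
    where
    open ≡-Reasoning
    1≢0 : 1 ≢ 0
    1≢0 ()

prepend : ℕ → (ℕ → ℕ) → (ℕ → ℕ)
prepend a v i with i <? a
... | yes _ = v i
... | no _  = v (i ∸ a)

-- A counterexample for R(p) and F yields one for p and p₁ + F: repeat the first
-- p₁ letters in front.
prepend-counterexample : ∀ {a b bs F} → OFS (a ∷ b ∷ bs) →
                         Counterexample (R (a ∷ b ∷ bs)) F → Counterexample (a ∷ b ∷ bs) (a + F)
prepend-counterexample {a} {b} {bs} {F} ofs v-ce = record
  { len = L + a ; word = w ; long = long ; periodic = periodic ; not-gcd = not-gcd }
  where
  open Counterexample v-ce using ()
    renaming (len to L; word to v; long to v-long; periodic to v-periodic; not-gcd to v-not-gcd)
  w = prepend a v
  v-period-a : HasPeriod L v a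
  v-period-a = v-periodic (a∈R ofs)
  w-shifted : ∀ j → w (j + a) ≡ v j
  w-shifted j with j + a <? a
  ... | yes j+a<a = ⊥-elim (<-irrefl refl (<-≤-trans j+a<a (m≤n+m a j)))
  ... | no _      = cong v (m+n∸n≡m j a)
  w-agrees : ∀ i → i < L → w i ≡ v i
  w-agrees i i<L with i <? a
  ... | yes _   = refl
  ... | no i≮a = trans (v-period-a (i ∸ a) (subst (_< L) (sym (m∸n+n≡m a≤i)) i<L)) (cong v (m∸n+n≡m a≤i))
    where
    a≤i : a ≤ i
    a≤i = ≮⇒≥ i≮a
  long : a + F ≤ suc (L + a)
  long = subst (a + F ≤_) (trans (+-suc a L) (cong suc (+-comm a L))) (+-monoʳ-≤ a v-long)
  periodic : ∀ {p} → p ∈ a ∷ b ∷ bs → HasPeriod (L + a) w p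
  periodic (here refl) i i+a<L+a =
    trans (w-agrees i (+-cancelʳ-< a i L i+a<L+a)) (sym (w-shifted i))
  periodic {c} (there c∈) i i+c<L+a = begin
    w i                   ≡⟨ w-agrees i (≤-<-trans (m≤m+n i (c ∸ a)) i+[c∸a]<L) ⟩
    v i                   ≡⟨ v-periodic (∸∈R ofs c∈) i i+[c∸a]<L ⟩
    v (i + (c ∸ a))       ≡⟨ w-shifted (i + (c ∸ a)) ⟨
    w (i + (c ∸ a) + a)   ≡⟨ cong w index ⟩
    w (i + c)             ∎
    where
    open ≡-Reasoning
    index : i + (c ∸ a) + a ≡ i + c
    index = trans (+-assoc i (c ∸ a) a) (cong (i +_) (m∸n+n≡m (first≤ ofs c∈)))
    i+[c∸a]<L : i + (c ∸ a) < L
    i+[c∸a]<L = +-cancelʳ-< a (i + (c ∸ a)) L (subst (_< L + a) (sym index) i+c<L+a)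
  -- a period gcd(p) of w would be one of v after deleting the first a letters
  not-gcd : ¬ HasPeriod (L + a) w (gcdL (a ∷ b ∷ bs))
  not-gcd per = v-not-gcd
    (subst₂ (λ n g → HasPeriod n v g) (m+n∸n≡m L a) (sym (gcdL-R ofs))
      (period-cong w-shifted (shift-period {a = a} per)))

f-sharp : ∀ k P → OFS P → sum P ≤ k → P ≢ [] → (∀ {y} → y ∈ P → y < fFuel k P) →
          Counterexample P (fFuel k P)
f-sharp k       []           _   _    P≢[] _     = ⊥-elim (P≢[] refl)
f-sharp zero    (a ∷ P)      ofs fuel _    _     = ⊥-elim (fuel-positive ofs fuel)
f-sharp (suc k) (a ∷ [])     _   _    _    below = ⊥-elim (<-irrefl refl (below (here refl)))
f-sharp (suc k) (a ∷ b ∷ bs) ofs fuel _    below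
  with any? (λ y → fFuel k (R (a ∷ b ∷ bs)) ≤? y) (R (a ∷ b ∷ bs))
... | no none-large = prepend-counterexample ofs
        (f-sharp k (R (a ∷ b ∷ bs)) (R-OFS ofs) (R-fuel ofs fuel) R≢[] (λ y∈ → ≰⇒> (none-large ∘ lose y∈)))
  where
  R≢[] : R (a ∷ b ∷ bs) ≢ []
  R≢[] R≡[] with subst (a ∈_) R≡[] (a∈R ofs)
  ... | ()
... | yes some-large with find some-large
-- the large entry of R(p) must be p₁, since pⱼ - p₁ ≥ f(R p) would give pⱼ ≥ f(p)
...   | y , y∈ , fR≤y with ∈R⁻ ofs y∈
...     | inj₁ refl = marker-counterexample ofs (below (there (here refl))) fR≤y
...     | inj₂ (c , c∈ , refl) = ⊥-elim (<-irrefl refl (<-≤-trans (below (there c∈))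
            (subst (_ ≤_) (m+[n∸m]≡n (first≤ ofs c∈)) (+-monoʳ-≤ a fR≤y))))

gcd[n,n]≡n : ∀ n → gcd n n ≡ n
gcd[n,n]≡n n = ∣-antisym (gcd[m,n]∣m n n) (gcd-greatest ∣-refl ∣-refl)

-- The Fine–Wilf theorem for periods x < y, as the periodicity lemma for (x, y).
fine-wilf-ordered : ∀ {L w x y} → 0 < x → x < y → HasPeriod L w x → HasPeriod L w y →
                    x + y ≤ L + gcd x y → HasPeriod L w (gcd x y)
fine-wilf-ordered {L} {w} {x} {y} 0<x x<y per-x per-y long =
  subst (HasPeriod L w) (cong (gcd x) (gcd-identityʳ y))
    (f-periodicity (sum (x ∷ y ∷ [])) (x ∷ y ∷ []) ((0<x ∷ <-trans 0<x x<y ∷ []) , (x<y ∷ [-])) ≤-refl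
      (+-cancelʳ-≤ (gcd x y) _ L (≤-trans (f-pair 0<x x<y) long)) periods)
  where
  periods : ∀ {p} → p ∈ x ∷ y ∷ [] → HasPeriod L w p
  periods (here refl)         = per-x
  periods (there (here refl)) = per-y

fine-wilf : ∀ {L w x y} → 0 < x → 0 < y → HasPeriod L w x → HasPeriod L w y →
            x + y ≤ L + gcd x y → HasPeriod L w (gcd x y)
fine-wilf {L} {w} {x} {y} 0<x 0<y per-x per-y long = by-order (<-cmp x y)
  where
  by-order : Tri (x < y) (x ≡ y) (y < x) → HasPeriod L w (gcd x y)
  by-order (tri≈ _ refl _) = subst (HasPeriod L w) (sym (gcd[n,n]≡n x)) per-x
  by-order (tri< x<y _ _) = fine-wilf-ordered 0<x x<y per-x per-y long
  by-order (tri> _ _ y<x) = subst (HasPeriod L w) (gcd-comm y x)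
    (fine-wilf-ordered 0<y y<x per-y per-x (subst₂ _≤_ (+-comm x y) (cong (L +_) (gcd-comm x y)) long))

OFS-prefix : ∀ q {x} → OFS (q ∷ʳ x) → OFS q
OFS-prefix q (positive , sorted) = ++⁻ˡ q positive , sorted-prefix q sorted
  where
  sorted-prefix : ∀ q {ys} → Linked _<_ (q ++ ys) → Linked _<_ q
  sorted-prefix []          _         = []
  sorted-prefix (a ∷ [])    _         = [-]
  sorted-prefix (a ∷ b ∷ q) (a<b ∷ l) = a<b ∷ sorted-prefix (b ∷ q) l

-- Otherwise f-sharp yields a word of length at least B with periods q and x but
-- not gcd(q ∷ʳ x), against the periodicity lemma for q and the Fine–Wilf theorem.
f-snoc-bound : ∀ {a qs x B} → OFS ((a ∷ qs) ∷ʳ x) → f (a ∷ qs) ≤ B →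
               x + gcdL (a ∷ qs) ≤ B + gcdL ((a ∷ qs) ∷ʳ x) → f ((a ∷ qs) ∷ʳ x) ≤ B
f-snoc-bound {a} {qs} {x} {B} ofs fq≤B room with f ((a ∷ qs) ∷ʳ x) ≤? B
... | yes fp≤B = fp≤B
... | no fp≰B  = ⊥-elim (not-gcd (subst (HasPeriod len word) (sym (gcdL-snoc q x)) gcd-period))
  where
  q = a ∷ qs
  p = q ∷ʳ x
  ofs-q : OFS q
  ofs-q = OFS-prefix q ofs
  G = gcdL q
  B<fp : B < f p
  B<fp = ≰⇒> fp≰B
  gcd≤G : gcdL p ≤ G
  gcd≤G = subst (_≤ G) (sym (gcdL-snoc q x)) (∣⇒≤ ⦃ >-nonZero (gcdL-positive ofs-q) ⦄ (gcd[m,n]∣m G x))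
  x≤B : x ≤ B
  x≤B = +-cancelʳ-≤ G x B (≤-trans room (+-monoʳ-≤ B gcd≤G))
  below : ∀ {y} → y ∈ p → y < f p
  below y∈ with ∈-++⁻ q y∈
  ... | inj₁ y∈q       = ≤-<-trans (≤-trans (f-≥-member (sum q) q ofs-q ≤-refl y∈q) fq≤B) B<fp
  ... | inj₂ (here refl) = ≤-<-trans x≤B B<fp
  open Counterexample (f-sharp (sum p) p ofs ≤-refl (λ ()) below)
  B≤len : B ≤ len
  B≤len = s≤s⁻¹ (≤-trans B<fp long)
  G-period : HasPeriod len word G
  G-period = f-periodicity (sum q) q ofs-q ≤-refl (≤-trans fq≤B B≤len) (periodic ∘ ∈-++⁺ˡ)
  gcd-period : HasPeriod len word (gcd G x)
  gcd-period = fine-wilf (gcdL-positive ofs-q) (All.lookup (proj₁ ofs) (∈-++⁺ʳ q (here refl)))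
    G-period (periodic (∈-++⁺ʳ q (here refl)))
    (subst₂ _≤_ (+-comm x G) (cong (len +_) (gcdL-snoc q x)) (≤-trans room (+-monoˡ-≤ _ B≤len)))

Redundant : List ℕ → ℕ → Set
Redundant q x = gcdL q ≡ gcdL (q ∷ʳ x) × f q ≤ x

redundant? : ∀ q x → Dec (Redundant q x)
redundant? q x = (gcdL q ≟ gcdL (q ∷ʳ x)) ×-dec (f q ≤? x)

redundantStep≡ : ∀ q x → redundantStep q x ≡ does (redundant? q x)
redundantStep≡ q x = cong₂ _∧_ (isYes≗does (gcdL q ≟ gcdL (q ∷ʳ x))) (isYes≗does (f q ≤? x))

fwRev-step : ∀ x rv → rv ≢ [] →
             fwRev (x ∷ rv) ≡ (if redundantStep (reverse rv) x then fwRev rv else f (reverse (x ∷ rv)))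
fwRev-step x []      rv≢[] = ⊥-elim (rv≢[] refl)
fwRev-step x (_ ∷ _) _     = refl

rRev-step : ∀ x rv → rv ≢ [] → rRev (x ∷ rv) ≡ bit (redundantStep (reverse rv) x) + rRev rv
rRev-step x []      rv≢[] = ⊥-elim (rv≢[] refl)
rRev-step x (_ ∷ _) _     = refl

-- fw and r are computed on the reversed list; these equations restate them
-- as appending one entry to a nonempty list.
module _ (a : ℕ) (qs : List ℕ) (x : ℕ) where

  private
    q = a ∷ qs

    reverse-snoc : reverse (q ∷ʳ x) ≡ x ∷ reverse q
    reverse-snoc = reverse-++ q (x ∷ [])

    reverse-nonempty : reverse q ≢ []
    reverse-nonempty rq≡[] = 0≢1+n (trans (sym (cong length rq≡[])) (length-reverse q))

  fw-snoc : fw (q ∷ʳ x) ≡ (if does (redundant? q x) then fw q else f (q ∷ʳ x))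
  fw-snoc = begin
    fwRev (reverse (q ∷ʳ x))  ≡⟨ cong fwRev reverse-snoc ⟩
    fwRev (x ∷ reverse q)     ≡⟨ fwRev-step x (reverse q) reverse-nonempty ⟩
    (if redundantStep (reverse (reverse q)) x then fw q else f (reverse (x ∷ reverse q)))
      ≡⟨ cong₂ (λ s t → if redundantStep s x then fw q else f t) (reverse-involutive q) reverse-twice ⟩
    (if redundantStep q x then fw q else f (q ∷ʳ x))
      ≡⟨ cong (λ d → if d then fw q else f (q ∷ʳ x)) (redundantStep≡ q x) ⟩
    (if does (redundant? q x) then fw q else f (q ∷ʳ x)) ∎
    where
    open ≡-Reasoning
    reverse-twice : reverse (x ∷ reverse q) ≡ q ∷ʳ x
    reverse-twice = trans (cong reverse (sym reverse-snoc)) (reverse-involutive (q ∷ʳ x))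

  r-snoc : r (q ∷ʳ x) ≡ bit (does (redundant? q x)) + r q
  r-snoc = begin
    rRev (reverse (q ∷ʳ x))  ≡⟨ cong rRev reverse-snoc ⟩
    rRev (x ∷ reverse q)     ≡⟨ rRev-step x (reverse q) reverse-nonempty ⟩
    bit (redundantStep (reverse (reverse q)) x) + r q ≡⟨ cong (λ s → bit (redundantStep s x) + r q) (reverse-involutive q) ⟩
    bit (redundantStep q x) + r q ≡⟨ cong (λ d → bit d + r q) (redundantStep≡ q x) ⟩
    bit (does (redundant? q x)) + r q ∎
    where open ≡-Reasoning

  snoc-redundant : Redundant q x → fw (q ∷ʳ x) ≡ fw q × r (q ∷ʳ x) ≡ suc (r q)
  snoc-redundant red =
    trans fw-snoc (cong (λ d → if d then fw q else f (q ∷ʳ x)) is-true) ,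
    trans r-snoc (cong (λ d → bit d + r q) is-true)
    where
    is-true : does (redundant? q x) ≡ true
    is-true = dec-true (redundant? q x) red

  snoc-irredundant : ¬ Redundant q x → fw (q ∷ʳ x) ≡ f (q ∷ʳ x) × r (q ∷ʳ x) ≡ r q
  snoc-irredundant irred =
    trans fw-snoc (cong (λ d → if d then fw q else f (q ∷ʳ x)) is-false) ,
    trans r-snoc (cong (λ d → bit d + r q) is-false)
    where
    is-false : does (redundant? q x) ≡ false
    is-false = dec-false (redundant? q x) irred

r≤length : ∀ a qs → r (a ∷ qs) ≤ length qs
r≤length a qs = bound (reverseView qs)
  where
  bound : ∀ {qs} → Reverse qs → r (a ∷ qs) ≤ length qs
  bound []              = z≤n
  bound (ys ∶ view ∶ʳ x) = begin
    r ((a ∷ ys) ∷ʳ x)                                      ≡⟨ r-snoc a ys x ⟩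
    bit (does (redundant? (a ∷ ys) x)) + r (a ∷ ys)        ≤⟨ +-mono-≤ (bit≤1 _) (bound view) ⟩
    1 + length ys                                          ≡⟨ +-comm 1 (length ys) ⟩
    length ys + 1                                          ≡⟨ length-++ ys ⟨
    length (ys ∷ʳ x)                                       ∎
    where
    open ≤-Reasoning
    bit≤1 : ∀ d → bit d ≤ 1
    bit≤1 true  = ≤-refl
    bit≤1 false = z≤n

lastL-snoc : ∀ a ys x → lastL a (ys ∷ʳ x) ≡ x
lastL-snoc a []       x = refl
lastL-snoc a (y ∷ ys) x = lastL-snoc y ys x

≤-⊔-cases : ∀ {m n o} → m ≤ n ⊔ o → m ≤ n ⊎ m ≤ o
≤-⊔-cases {m} {n} {o} m≤n⊔o with ⊔-sel n o
... | inj₁ n⊔o≡n = inj₁ (subst (m ≤_) n⊔o≡n m≤n⊔o)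
... | inj₂ n⊔o≡o = inj₂ (subst (m ≤_) n⊔o≡o m≤n⊔o)

proper-divisor : ∀ {d n} → d ∣ n → 0 < n → d ≢ n → d + d ≤ n
proper-divisor     (divides zero refl)          () _
proper-divisor {d} (divides (suc zero) refl)     _ d≢n = ⊥-elim (d≢n (sym (+-identityʳ d)))
proper-divisor {d} (divides (suc (suc m)) refl) _ _   = +-monoʳ-≤ d (m≤m+n d (m * d))

next-multiple : ∀ {g a n} → g ∣ a → g * n < a → g * suc n ≤ a
next-multiple {g} {_} {n} (divides m refl) g*n<a = begin
  g * suc n ≤⟨ *-monoʳ-≤ g (*-cancelʳ-< g n m (subst (_< m * g) (*-comm g n) g*n<a)) ⟩
  g * m     ≡⟨ *-comm g m ⟩
  m * g     ∎
  where open ≤-Reasoning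

-- The invariant of the induction

irredundants : ℕ → List ℕ → ℕ
irredundants a rest = length rest ∸ r (a ∷ rest)

record Invariant (a : ℕ) (rest : List ℕ) : Set where
  field
    bound   : fw (a ∷ rest) + gcdL (a ∷ rest) * irredundants a rest ≤ a + lastL a rest
    spacing : gcdL (a ∷ rest) * suc (irredundants a rest) ≤ a
    f-below : f (a ∷ rest) ≤ fw (a ∷ rest) ⊔ lastL a rest

invariant-single : ∀ {a} → 0 < a → Invariant a []
invariant-single {suc a′} _ = record
  { bound   = subst (λ g → a + g * 0 ≤ a + a) (sym (gcd-identityʳ a)) (+-monoʳ-≤ a (subst (_≤ a) (sym (*-zeroʳ a)) z≤n))
  ; spacing = ≤-reflexive (trans (cong (_* 1) (gcd-identityʳ a)) (*-identityʳ a))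
  ; f-below = m≤m⊔n a a
  }
  where a = suc a′

snoc-above : ∀ q {x} → Linked _<_ (q ∷ʳ x) → All (_< x) q
snoc-above []      _ = []
snoc-above (z ∷ q) l = All.lookup (head-below l) (∈-++⁺ʳ q (here refl)) ∷ snoc-above q (Linked.tail l)

lastL∈ : ∀ a ys → lastL a ys ∈ a ∷ ys
lastL∈ a []       = here refl
lastL∈ a (y ∷ ys) = there (lastL∈ y ys)

module _ {a ys x} (ofs : OFS ((a ∷ ys) ∷ʳ x)) (IH : Invariant a ys) where

  private
    q = a ∷ ys
    p = q ∷ʳ x
    y = lastL a ys
    G = gcdL q
    g = gcdL p
    c = irredundants a ys
    open Invariant IH renaming (bound to bound-q; spacing to spacing-q; f-below to f-below-q)
    open ≤-Reasoning

    ofs-q : OFS q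
    ofs-q = OFS-prefix q ofs

    g∣G : g ∣ G
    g∣G = subst (_∣ G) (sym (gcdL-snoc q x)) (gcd[m,n]∣m G x)

    g≤G : g ≤ G
    g≤G = ∣⇒≤ ⦃ >-nonZero (gcdL-positive ofs-q) ⦄ g∣G

    y<x : y < x
    y<x = All.lookup (snoc-above q (proj₂ ofs)) (lastL∈ a ys)

    -- consecutive multiples of g: x - y is a positive multiple of g
    y+g≤x : y + g ≤ x
    y+g≤x = begin
      y + g        ≤⟨ +-monoʳ-≤ y (∣⇒≤ ⦃ >-nonZero (m<n⇒0<n∸m y<x) ⦄ g∣x∸y) ⟩
      y + (x ∸ y)  ≡⟨ m+[n∸m]≡n (<⇒≤ y<x) ⟩
      x            ∎
      where
      g∣x∸y : g ∣ x ∸ y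
      g∣x∸y = ∣-∸ (<⇒≤ y<x) (gcdL-∣ p (∈-++⁺ˡ (lastL∈ a ys))) (gcdL-∣ p (∈-++⁺ʳ q (here refl)))

    -- f-snoc-bound with the least admissible B
    f-extend : f p ≤ f q ⊔ (x + G ∸ g)
    f-extend = f-snoc-bound ofs (m≤m⊔n (f q) _) (begin
      x + G                   ≡⟨ m∸n+n≡m (≤-trans g≤G (m≤n+m G x)) ⟨
      x + G ∸ g + g           ≤⟨ +-monoˡ-≤ g (m≤n⊔m (f q) _) ⟩
      f q ⊔ (x + G ∸ g) + g   ∎)

    length-snoc : length (ys ∷ʳ x) ≡ suc (length ys)
    length-snoc = trans (length-++ ys) (+-comm (length ys) 1)

    last≡x : lastL a (ys ∷ʳ x) ≡ x
    last≡x = lastL-snoc a ys x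

  redundant-step : Redundant q x → Invariant a (ys ∷ʳ x)
  redundant-step red@(G≡g , fq≤x) = record
    { bound = begin
        fw p + g * irredundants a (ys ∷ʳ x) ≡⟨ cong₂ (λ u v → u + v * irredundants a (ys ∷ʳ x)) fw≡ (sym G≡g) ⟩
        fw q + G * irredundants a (ys ∷ʳ x) ≡⟨ cong (λ n → fw q + G * n) count≡ ⟩
        fw q + G * c                        ≤⟨ bound-q ⟩
        a + y                               ≤⟨ +-monoʳ-≤ a (<⇒≤ y<x) ⟩
        a + x                               ≡⟨ cong (a +_) last≡x ⟨
        a + lastL a (ys ∷ʳ x)               ∎
    ; spacing = subst₂ (λ h n → h * suc n ≤ a) G≡g (sym count≡) spacing-q
    ; f-below = begin
        f p                   ≤⟨ f-extend ⟩
        f q ⊔ (x + G ∸ g)     ≡⟨ cong (λ h → f q ⊔ (x + h ∸ g)) G≡g ⟩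
        f q ⊔ (x + g ∸ g)     ≡⟨ cong (f q ⊔_) (m+n∸n≡m x g) ⟩
        f q ⊔ x               ≤⟨ ⊔-lub fq≤x ≤-refl ⟩
        x                     ≤⟨ m≤n⊔m (fw p) x ⟩
        fw p ⊔ x              ≡⟨ cong (fw p ⊔_) last≡x ⟨
        fw p ⊔ lastL a (ys ∷ʳ x) ∎
    }
    where
    fw≡ : fw p ≡ fw q
    fw≡ = proj₁ (snoc-redundant a ys x red)
    count≡ : irredundants a (ys ∷ʳ x) ≡ c
    count≡ = cong₂ _∸_ length-snoc (proj₂ (snoc-redundant a ys x red))

  -- The bound after an irredundant entry: f(p) is estimated through one of the
  -- two terms of f-extend, and f(q) through one of the two terms of f-below-q.
  irredundant-bound : f p + g * suc c ≤ a + x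
  irredundant-bound with ≤-⊔-cases f-extend
  ... | inj₂ fp≤x+G∸g = begin
    f p + g * suc c          ≤⟨ +-monoˡ-≤ _ fp≤x+G∸g ⟩
    x + G ∸ g + g * suc c    ≡⟨ cong (x + G ∸ g +_) (*-suc g c) ⟩
    x + G ∸ g + (g + g * c)  ≡⟨ +-assoc (x + G ∸ g) g (g * c) ⟨
    x + G ∸ g + g + g * c    ≡⟨ cong (_+ g * c) (m∸n+n≡m (≤-trans g≤G (m≤n+m G x))) ⟩
    x + G + g * c            ≤⟨ +-monoʳ-≤ (x + G) (*-monoˡ-≤ c g≤G) ⟩
    x + G + G * c            ≡⟨ trans (+-assoc x G (G * c)) (cong (x +_) (sym (*-suc G c))) ⟩
    x + G * suc c            ≤⟨ +-monoʳ-≤ x spacing-q ⟩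
    x + a                    ≡⟨ +-comm x a ⟩
    a + x                    ∎
  ... | inj₁ fp≤fq with ≤-⊔-cases f-below-q
  ...   | inj₁ fq≤fw = begin
    f p + g * suc c          ≤⟨ +-monoˡ-≤ _ (≤-trans fp≤fq fq≤fw) ⟩
    fw q + g * suc c         ≡⟨ cong (fw q +_) (*-suc g c) ⟩
    fw q + (g + g * c)       ≡⟨ x∙yz≈xz∙y (fw q) g (g * c) ⟩
    fw q + g * c + g         ≤⟨ +-monoˡ-≤ g (+-monoʳ-≤ (fw q) (*-monoˡ-≤ c g≤G)) ⟩
    fw q + G * c + g         ≤⟨ +-monoˡ-≤ g bound-q ⟩
    a + y + g                ≡⟨ +-assoc a y g ⟩
    a + (y + g)              ≤⟨ +-monoʳ-≤ a y+g≤x ⟩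
    a + x                    ∎
  ...   | inj₂ fq≤y = begin
    f p + g * suc c          ≤⟨ +-mono-≤ (≤-trans fp≤fq fq≤y) (*-monoˡ-≤ (suc c) g≤G) ⟩
    y + G * suc c            ≤⟨ +-monoʳ-≤ y spacing-q ⟩
    y + a                    ≤⟨ +-monoˡ-≤ a (<⇒≤ y<x) ⟩
    x + a                    ≡⟨ +-comm x a ⟩
    a + x                    ∎

  -- The spacing after an irredundant entry: if the gcd drops, it at least
  -- halves; otherwise f(q) > x, and g · (c + 1) < p₁ leaves room for one more
  -- multiple of g.
  irredundant-spacing : ¬ Redundant q x → g * suc (suc c) ≤ a
  irredundant-spacing irred with G ≟ g
  ... | no G≢g = begin
    g * suc (suc c)        ≤⟨ *-monoʳ-≤ g (s≤s (m≤n+m (suc c) c)) ⟩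
    g * (suc c + suc c)    ≡⟨ *-distribˡ-+ g (suc c) (suc c) ⟩
    g * suc c + g * suc c  ≡⟨ *-distribʳ-+ (suc c) g g ⟨
    (g + g) * suc c        ≤⟨ *-monoˡ-≤ (suc c) (proper-divisor g∣G (gcdL-positive ofs-q) (G≢g ∘ sym)) ⟩
    G * suc c              ≤⟨ spacing-q ⟩
    a                      ∎
  ... | yes G≡g = next-multiple (gcdL-∣ p (here refl)) (+-cancelˡ-< y _ a (begin-strict
    y + g * suc c          ≡⟨ cong (y +_) (*-suc g c) ⟩
    y + (g + g * c)        ≡⟨ +-assoc y g (g * c) ⟨
    y + g + g * c          <⟨ +-monoˡ-< (g * c) (≤-<-trans y+g≤x x<fq) ⟩
    f q + g * c            ≤⟨ +-mono-≤ fq≤fw (*-monoˡ-≤ c g≤G) ⟩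
    fw q + G * c           ≤⟨ bound-q ⟩
    a + y                  ≡⟨ +-comm a y ⟩
    y + a                  ∎))
    where
    x<fq : x < f q
    x<fq = ≰⇒> (λ fq≤x → irred (G≡g , fq≤x))
    fq≤fw : f q ≤ fw q
    fq≤fw with ≤-⊔-cases f-below-q
    ... | inj₁ fq≤fw = fq≤fw
    ... | inj₂ fq≤y  = ⊥-elim (<⇒≱ (<-trans y<x x<fq) fq≤y)

  irredundant-step : ¬ Redundant q x → Invariant a (ys ∷ʳ x)
  irredundant-step irred = record
    { bound   = subst₂ (λ u n → u + g * n ≤ a + lastL a (ys ∷ʳ x)) (sym fw≡) (sym count≡)
                  (subst (λ l → f p + g * suc c ≤ a + l) (sym last≡x) irredundant-bound)
    ; spacing = subst (λ n → g * suc n ≤ a) (sym count≡) (irredundant-spacing irred)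
    ; f-below = subst (f p ≤_) (cong₂ _⊔_ (sym fw≡) refl) (m≤m⊔n (f p) _)
    }
    where
    fw≡ : fw p ≡ f p
    fw≡ = proj₁ (snoc-irredundant a ys x irred)
    count≡ : irredundants a (ys ∷ʳ x) ≡ suc c
    count≡ = trans (cong₂ _∸_ length-snoc (proj₂ (snoc-irredundant a ys x irred)))
                   (+-∸-assoc 1 (r≤length a ys))

  extend : Invariant a (ys ∷ʳ x)
  extend with redundant? q x
  ... | yes red  = redundant-step red
  ... | no irred = irredundant-step irred

invariant : ∀ a rest → OFS (a ∷ rest) → Invariant a rest
invariant a rest = along (reverseView rest)
  where
  along : ∀ {rest} → Reverse rest → OFS (a ∷ rest) → Invariant a rest
  along []               ofs = invariant-single (All.head (proj₁ ofs))
  along (ys ∶ view ∶ʳ x) ofs = extend ofs (along view (OFS-prefix (a ∷ ys) ofs))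

proposition39 : (a : ℕ) (rest : List ℕ) → OFS (a ∷ rest) →
    fw (a ∷ rest) + gcdL (a ∷ rest) * (length (a ∷ rest) ∸ 1 ∸ r (a ∷ rest))
      ≤ a + lastL a rest
proposition39 a rest ofs = Invariant.bound (invariant a rest ofs)
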